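{- (1) If $(\Gamma,x{:}A);\Omega;\Delta\vdash M:C$ and $(\Gamma,\Delta);\Omega;\cdot\vdash N:A$, then $\Gamma;\Omega;\Delta\vdash[N/x]M:C$. (2) If $\Gamma;(\Omega,x{:}A);\Delta\vdash M:C$ and $(\Gamma,\Delta,\Omega);\cdot;\cdot\vdash N:A$, then $\Gamma;\Omega;\Delta\vdash[N/x]M:C$. (3) If $(\Gamma,\Delta_N);\Omega;(\Delta_M,x{:}A)\vdash M:C$ and $(\Gamma,\Delta_M);\Omega;\Delta_N\vdash N:A$, then $\Gamma;\Omega;(\Delta_M,\Delta_N)\vdash[N/x]M:C$.
   Context: Strict $\lambda$-calculus over a signature $\Sigma$. Labels $k\in\{1,0,u\}$; types $A::=a\mid A_1\to^kA_2$; terms $c\mid x\mid\lambda x^k{:}A.M\mid M_1M_2^k$ (up to renaming of bound variables); $[N/x]M$ is capture-avoiding substitution. Contexts: finite sets of declarations with distinct variables; commas denote disjoint unions. Typing $\Gamma;\Omega;\Delta\vdash M:A$ ($\Gamma$ unrestricted, $\Omega$ irrelevant, $\Delta$ strict; pairwise disjoint): if $c{:}A\in\Sigma$ then $\Gamma;\Omega;\cdot\vdash c:A$; $(\Gamma,x{:}A);\Omega;\cdot\vdash x:A$; $\Gamma;\Omega;x{:}A\vdash x:A$ (no rule for $\Omega$); from $(\Gamma,x{:}A);\Omega;\Delta\vdash M:B$ infer $\Gamma;\Omega;\Delta\vdash\lambda x^u{:}A.M:A\to^uB$; from $\Gamma;(\Omega,x{:}A);\Delta\vdash M:B$ infer $\Gamma;\Omega;\Delta\vdash\lambda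 x^0{:}A.M:A\to^0B$; from $\Gamma;\Omega;(\Delta,x{:}A)\vdash M:B$ infer $\Gamma;\Omega;\Delta\vdash\lambda x^1{:}A.M:A\to^1B$; from $\Gamma;\Omega;\Delta\vdash M:A\to^uB$ and $(\Gamma,\Delta);\Omega;\cdot\vdash N:A$ infer $\Gamma;\Omega;\Delta\vdash MN^u:B$; from $\Gamma;\Omega;\Delta\vdash M:A\to^0B$ and $(\Gamma,\Omega,\Delta);\cdot;\cdot\vdash N:A$ infer $\Gamma;\Omega;\Delta\vdash MN^0:B$; from $(\Gamma,\Delta_N);\Omega;\Delta_M\vdash M:A\to^1B$ and $(\Gamma,\Delta_M);\Omega;\Delta_N\vdash N:A$ infer $\Gamma;\Omega;(\Delta_M,\Delta_N)\vdash MN^1:B$. -}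

module Defs where

open import Data.Nat using (ℕ; zero; suc)
open import Data.Fin using (Fin; zero; suc)
open import Data.Vec using (Vec; []; _∷_; lookup; map)
open import Data.Product using (_×_; _,_; proj₁)
open import Relation.Binary.PropositionalEquality using (_≡_; _≢_)

-- Labels k ∈ {1, 0, u}.  The same three labels also name the three
-- zones of a typing context: strict (1), irrelevant (0), unrestricted (u).
data Label : Set where
  𝟏 𝟎 𝐮 : Label

data Ty (B : Set) : Set where
  base  : B → Ty B
  _⇒[_]_ : Ty B → Label → Ty B → Ty B

-- Terms over a set K of constants, with n free variables (de Bruijn,
-- so terms are identified up to renaming of bound variables).
data Tm (B K : Set) : ℕ → Set where
  con : ∀ {n} → K → Tm B K n
  var : ∀ {n} → Fin n → Tm B K n
  lam : ∀ {n} → Label → Ty B → Tm B K (suc n) → Tm B K n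
  app : ∀ {n} → Tm B K n → Tm B K n → Label → Tm B K n

ext : ∀ {m n} → (Fin m → Fin n) → Fin (suc m) → Fin (suc n)
ext ρ zero    = zero
ext ρ (suc i) = suc (ρ i)

rename : ∀ {B K m n} → (Fin m → Fin n) → Tm B K m → Tm B K n
rename ρ (con c)     = con c
rename ρ (var i)     = var (ρ i)
rename ρ (lam k A M) = lam k A (rename (ext ρ) M)
rename ρ (app M N k) = app (rename ρ M) (rename ρ N) k

exts : ∀ {B K m n} → (Fin m → Tm B K n) → Fin (suc m) → Tm B K (suc n)
exts σ zero    = var zero
exts σ (suc i) = rename suc (σ i)

subst : ∀ {B K m n} → (Fin m → Tm B K n) → Tm B K m → Tm B K n
subst σ (con c)     = con c
subst σ (var i)     = σ i
subst σ (lam k A M) = lam k A (subst (exts σ) M)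
subst σ (app M N k) = app (subst σ M) (subst σ N) k

-- [N/x]M where x is the variable 0.
sub0 : ∀ {B K n} → Tm B K n → Fin (suc n) → Tm B K n
sub0 N zero    = N
sub0 N (suc i) = var i

_[_] : ∀ {B K n} → Tm B K (suc n) → Tm B K n → Tm B K n
M [ N ] = subst (sub0 N) M

-- A combined context Γ;Ω;Δ: each declaration carries its zone.
Ctx : Set → ℕ → Set
Ctx B n = Vec (Label × Ty B) n

NoStrict : ∀ {B n} → Ctx B n → Set
NoStrict Ψ = ∀ j → proj₁ (lookup Ψ j) ≢ 𝟏

OnlyStrict : ∀ {B n} → Fin n → Ctx B n → Set
OnlyStrict i Ψ = ∀ j → j ≢ i → proj₁ (lookup Ψ j) ≢ 𝟏

-- Γ;Ω;Δ  ↦  (Γ,Δ);Ω;·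
strictToUnr : ∀ {B n} → Ctx B n → Ctx B n
strictToUnr = map f
  where
  f : ∀ {B} → Label × Ty B → Label × Ty B
  f (𝟏 , A) = 𝐮 , A
  f (k , A) = k , A

-- Γ;Ω;Δ  ↦  (Γ,Ω,Δ);·;·
allUnr : ∀ {B n} → Ctx B n → Ctx B n
allUnr = map (λ { (k , A) → 𝐮 , A })

-- Split Ψ Ψₘ Ψₙ : Ψ = Γ;Ω;(Δ_M,Δ_N), Ψₘ = (Γ,Δ_N);Ω;Δ_M, Ψₙ = (Γ,Δ_M);Ω;Δ_N
data Split {B : Set} : ∀ {n} → Ctx B n → Ctx B n → Ctx B n → Set where
  []   : Split [] [] []
  unr  : ∀ {n A} {Ψ Ψₘ Ψₙ : Ctx B n} → Split Ψ Ψₘ Ψₙ →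
         Split ((𝐮 , A) ∷ Ψ) ((𝐮 , A) ∷ Ψₘ) ((𝐮 , A) ∷ Ψₙ)
  irr  : ∀ {n A} {Ψ Ψₘ Ψₙ : Ctx B n} → Split Ψ Ψₘ Ψₙ →
         Split ((𝟎 , A) ∷ Ψ) ((𝟎 , A) ∷ Ψₘ) ((𝟎 , A) ∷ Ψₙ)
  strL : ∀ {n A} {Ψ Ψₘ Ψₙ : Ctx B n} → Split Ψ Ψₘ Ψₙ →
         Split ((𝟏 , A) ∷ Ψ) ((𝟏 , A) ∷ Ψₘ) ((𝐮 , A) ∷ Ψₙ)
  strR : ∀ {n A} {Ψ Ψₘ Ψₙ : Ctx B n} → Split Ψ Ψₘ Ψₙ →
         Split ((𝟏 , A) ∷ Ψ) ((𝐮 , A) ∷ Ψₘ) ((𝟏 , A) ∷ Ψₙ)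

-- Typing  Γ;Ω;Δ ⊢ M : A  over a signature Σ (constant c has type Σ c),
-- written  Σ ∣ Ψ ⊢ M ⦂ A  where Ψ is the combined context.
data _∣_⊢_⦂_ {B K : Set} (Σ : K → Ty B) :
       ∀ {n} → Ctx B n → Tm B K n → Ty B → Set where
  t-con  : ∀ {n} {Ψ : Ctx B n} {c} → NoStrict Ψ → Σ ∣ Ψ ⊢ con c ⦂ Σ c
  t-varU : ∀ {n} {Ψ : Ctx B n} {i A} → lookup Ψ i ≡ (𝐮 , A) → NoStrict Ψ →
           Σ ∣ Ψ ⊢ var i ⦂ A
  t-var1 : ∀ {n} {Ψ : Ctx B n} {i A} → lookup Ψ i ≡ (𝟏 , A) → OnlyStrict i Ψ →
           Σ ∣ Ψ ⊢ var i ⦂ A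
  t-lam  : ∀ {n} {Ψ : Ctx B n} {k A C M} → Σ ∣ (k , A) ∷ Ψ ⊢ M ⦂ C →
           Σ ∣ Ψ ⊢ lam k A M ⦂ (A ⇒[ k ] C)
  t-appU : ∀ {n} {Ψ : Ctx B n} {A C M N} →
           Σ ∣ Ψ ⊢ M ⦂ (A ⇒[ 𝐮 ] C) → Σ ∣ strictToUnr Ψ ⊢ N ⦂ A →
           Σ ∣ Ψ ⊢ app M N 𝐮 ⦂ C
  t-app0 : ∀ {n} {Ψ : Ctx B n} {A C M N} →
           Σ ∣ Ψ ⊢ M ⦂ (A ⇒[ 𝟎 ] C) → Σ ∣ allUnr Ψ ⊢ N ⦂ A →
           Σ ∣ Ψ ⊢ app M N 𝟎 ⦂ C
  t-app1 : ∀ {n} {Ψ Ψₘ Ψₙ : Ctx B n} {A C M N} → Split Ψ Ψₘ Ψₙ →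
           Σ ∣ Ψₘ ⊢ M ⦂ (A ⇒[ 𝟏 ] C) → Σ ∣ Ψₙ ⊢ N ⦂ A →
           Σ ∣ Ψ ⊢ app M N 𝟏 ⦂ C

{-# OPTIONS --safe #-}
module Submission where

open import Defs
open import Data.Nat using (ℕ; zero; suc)
open import Data.Fin using (Fin; zero; suc; punchIn; _≟_)
open import Data.Fin.Properties using (punchIn-injective; punchInᵢ≢i)
open import Data.Vec using (Vec; []; _∷_; lookup; insertAt)
open import Data.Vec.Properties using (map-insertAt; insertAt-lookup; insertAt-punchIn)
open import Data.Product using (_×_; _,_; proj₁; proj₂; ∃-syntax)
open import Data.Sum using (_⊎_; inj₁; inj₂)
open import Data.Empty using (⊥-elim)
open import Function using (_∘_)
open import Relation.Nullary using (yes; no)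
open import Relation.Binary.PropositionalEquality using (_≡_; _≢_; _≗_; refl; sym; trans; cong)

-- The substitution lemma is proved for a variable at an arbitrary position p of
-- the context, since that position moves when the induction passes a binder; the
-- zone of the variable decides how it is distributed over applications.  Two
-- structural properties carry the induction: weakening by a non-strict variable
-- (to push N under binders), and promotion: a derivation stays valid when strict
-- or irrelevant declarations become unrestricted.  Promotion is what lets N be
-- used inside the argument contexts strictToUnr Ψ and allUnr Ψ of u- and
-- 0-applications.  A strict x occurs in exactly one side of a strict application;
-- re-associating the context splits hands the strict variables of N to that side,
-- while the other side sees x, and all of N's context, as unrestricted.

data PunchInView {n} (p : Fin (suc n)) : Fin (suc n) → Set where
  here  : PunchInView p p
  there : ∀ j → PunchInView p (punchIn p j)

punchInView : ∀ {n} (p i : Fin (suc n)) → PunchInView p i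
punchInView         zero    zero    = here
punchInView         zero    (suc i) = there i
punchInView {suc n} (suc p) zero    = there zero
punchInView {suc n} (suc p) (suc i) with punchInView p i
... | here    = here
... | there j = there (suc j)

data LookupInsertAt {A : Set} {n} (xs : Vec A n) (p : Fin (suc n)) (x y : A) :
       Fin (suc n) → Set where
  here  : x ≡ y → LookupInsertAt xs p x y p
  there : ∀ j → lookup xs j ≡ y → LookupInsertAt xs p x y (punchIn p j)

lookupInsertAt : ∀ {A : Set} {n} (xs : Vec A n) (p : Fin (suc n)) {x y : A} i →
                 lookup (insertAt xs p x) i ≡ y → LookupInsertAt xs p x y i
lookupInsertAt xs p i e with punchInView p i
... | here    = here (trans (sym (insertAt-lookup xs p _)) e)
... | there j = there j (trans (sym (insertAt-punchIn xs p _ j)) e)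

𝐮≢𝟏 : 𝐮 ≢ 𝟏
𝐮≢𝟏 ()

strictToUnrLabel : Label → Label
strictToUnrLabel 𝟏 = 𝐮
strictToUnrLabel 𝟎 = 𝟎
strictToUnrLabel 𝐮 = 𝐮

strictToUnrLabel≢𝟏 : ∀ k → strictToUnrLabel k ≢ 𝟏
strictToUnrLabel≢𝟏 𝟏 ()
strictToUnrLabel≢𝟏 𝟎 ()
strictToUnrLabel≢𝟏 𝐮 ()

data _⊑_ : Label → Label → Set where
  ⊑-refl : ∀ {k} → k ⊑ k
  𝟎⊑𝐮    : 𝟎 ⊑ 𝐮
  𝟏⊑𝐮    : 𝟏 ⊑ 𝐮

data _≼_ {B : Set} : ∀ {n} → Ctx B n → Ctx B n → Set where
  []  : [] ≼ []
  _∷_ : ∀ {n k k' A} {Ψ Ψ' : Ctx B n} → k ⊑ k' → Ψ ≼ Ψ' →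
        ((k , A) ∷ Ψ) ≼ ((k' , A) ∷ Ψ')

module _ {B : Set} where

  strictToUnr-insertAt : ∀ {n} (Ψ : Ctx B n) p k {A} →
    strictToUnr (insertAt Ψ p (k , A)) ≡ insertAt (strictToUnr Ψ) p (strictToUnrLabel k , A)
  strictToUnr-insertAt Ψ p 𝟏 = map-insertAt _ _ Ψ p
  strictToUnr-insertAt Ψ p 𝟎 = map-insertAt _ _ Ψ p
  strictToUnr-insertAt Ψ p 𝐮 = map-insertAt _ _ Ψ p

  allUnr-insertAt : ∀ {n} (Ψ : Ctx B n) p {k A} →
    allUnr (insertAt Ψ p (k , A)) ≡ insertAt (allUnr Ψ) p (𝐮 , A)
  allUnr-insertAt Ψ p = map-insertAt _ _ Ψ p

  strictToUnr-idem : ∀ {n} (Ψ : Ctx B n) → strictToUnr (strictToUnr Ψ) ≡ strictToUnr Ψ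
  strictToUnr-idem []            = refl
  strictToUnr-idem ((𝟏 , A) ∷ Ψ) = cong (_ ∷_) (strictToUnr-idem Ψ)
  strictToUnr-idem ((𝟎 , A) ∷ Ψ) = cong (_ ∷_) (strictToUnr-idem Ψ)
  strictToUnr-idem ((𝐮 , A) ∷ Ψ) = cong (_ ∷_) (strictToUnr-idem Ψ)

  strictToUnr-allUnr : ∀ {n} (Ψ : Ctx B n) → strictToUnr (allUnr Ψ) ≡ allUnr Ψ
  strictToUnr-allUnr []      = refl
  strictToUnr-allUnr (_ ∷ Ψ) = cong (_ ∷_) (strictToUnr-allUnr Ψ)

  allUnr-strictToUnr : ∀ {n} (Ψ : Ctx B n) → allUnr (strictToUnr Ψ) ≡ allUnr Ψ
  allUnr-strictToUnr []            = refl
  allUnr-strictToUnr ((𝟏 , A) ∷ Ψ) = cong (_ ∷_) (allUnr-strictToUnr Ψ)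
  allUnr-strictToUnr ((𝟎 , A) ∷ Ψ) = cong (_ ∷_) (allUnr-strictToUnr Ψ)
  allUnr-strictToUnr ((𝐮 , A) ∷ Ψ) = cong (_ ∷_) (allUnr-strictToUnr Ψ)

  NoStrict⇒strictToUnr≡id : ∀ {n} (Ψ : Ctx B n) → NoStrict Ψ → strictToUnr Ψ ≡ Ψ
  NoStrict⇒strictToUnr≡id []            ns = refl
  NoStrict⇒strictToUnr≡id ((𝟏 , A) ∷ Ψ) ns = ⊥-elim (ns zero refl)
  NoStrict⇒strictToUnr≡id ((𝟎 , A) ∷ Ψ) ns =
    cong (_ ∷_) (NoStrict⇒strictToUnr≡id Ψ (ns ∘ suc))
  NoStrict⇒strictToUnr≡id ((𝐮 , A) ∷ Ψ) ns =
    cong (_ ∷_) (NoStrict⇒strictToUnr≡id Ψ (ns ∘ suc))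

  NoStrict-insertAt⁺ : ∀ {n} (Ψ : Ctx B n) p {k A} → k ≢ 𝟏 → NoStrict Ψ →
                       NoStrict (insertAt Ψ p (k , A))
  NoStrict-insertAt⁺ Ψ p k≢𝟏 ns i e with lookupInsertAt Ψ p i refl
  ... | here x≡    = k≢𝟏 (trans (cong proj₁ x≡) e)
  ... | there j x≡ = ns j (trans (cong proj₁ x≡) e)

  NoStrict-insertAt⁻ : ∀ {n} (Ψ : Ctx B n) p {k A} → NoStrict (insertAt Ψ p (k , A)) →
                       k ≢ 𝟏 × NoStrict Ψ
  NoStrict-insertAt⁻ Ψ p ns =
      (λ e → ns p (trans (cong proj₁ (insertAt-lookup Ψ p _)) e))
    , (λ j e → ns (punchIn p j) (trans (cong proj₁ (insertAt-punchIn Ψ p _ j)) e))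

  OnlyStrict-insertAt⁺ : ∀ {n} (Ψ : Ctx B n) p {k A i} → k ≢ 𝟏 → OnlyStrict i Ψ →
                         OnlyStrict (punchIn p i) (insertAt Ψ p (k , A))
  OnlyStrict-insertAt⁺ Ψ p k≢𝟏 os i' i'≢ e with lookupInsertAt Ψ p i' refl
  ... | here x≡    = k≢𝟏 (trans (cong proj₁ x≡) e)
  ... | there j x≡ = os j (i'≢ ∘ cong (punchIn p)) (trans (cong proj₁ x≡) e)

  OnlyStrict-insertAt⁻ : ∀ {n} (Ψ : Ctx B n) p {k A i} →
                         OnlyStrict (punchIn p i) (insertAt Ψ p (k , A)) → k ≢ 𝟏 × OnlyStrict i Ψ
  OnlyStrict-insertAt⁻ Ψ p {i = i} os =
      (λ e → os p (punchInᵢ≢i p i ∘ sym) (trans (cong proj₁ (insertAt-lookup Ψ p _)) e))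
    , (λ j j≢i e → os (punchIn p j) (j≢i ∘ punchIn-injective p j i)
                      (trans (cong proj₁ (insertAt-punchIn Ψ p _ j)) e))

  OnlyStrict-insertAt-here : ∀ {n} (Ψ : Ctx B n) p {x} →
                             OnlyStrict p (insertAt Ψ p x) → NoStrict Ψ
  OnlyStrict-insertAt-here Ψ p os j e =
    os (punchIn p j) (punchInᵢ≢i p j) (trans (cong proj₁ (insertAt-punchIn Ψ p _ j)) e)

  split-swap : ∀ {n} {Ψ Ψₘ Ψₙ : Ctx B n} → Split Ψ Ψₘ Ψₙ → Split Ψ Ψₙ Ψₘ
  split-swap []       = []
  split-swap (unr s)  = unr (split-swap s)
  split-swap (irr s)  = irr (split-swap s)
  split-swap (strL s) = strR (split-swap s)
  split-swap (strR s) = strL (split-swap s)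

  split-assoc : ∀ {n} {Ψ Ψₘ Ψₙ Ψ₁ Ψ₂ : Ctx B n} → Split Ψ Ψₘ Ψₙ → Split Ψₘ Ψ₁ Ψ₂ →
                ∃[ Ψ₂ₙ ] (Split Ψ Ψ₁ Ψ₂ₙ × Split Ψ₂ₙ Ψ₂ Ψₙ)
  split-assoc [] [] = _ , [] , []
  split-assoc (unr s) (unr t) with split-assoc s t
  ... | _ , a , b = _ , unr a , unr b
  split-assoc (irr s) (irr t) with split-assoc s t
  ... | _ , a , b = _ , irr a , irr b
  split-assoc (strL s) (strL t) with split-assoc s t
  ... | _ , a , b = _ , strL a , unr b
  split-assoc (strL s) (strR t) with split-assoc s t
  ... | _ , a , b = _ , strR a , strL b
  split-assoc (strR s) (unr t) with split-assoc s t
  ... | _ , a , b = _ , strR a , strR b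

  split-strictToUnrˡ : ∀ {n} {Ψ Ψₘ Ψₙ : Ctx B n} → Split Ψ Ψₘ Ψₙ →
                       strictToUnr Ψₘ ≡ strictToUnr Ψ
  split-strictToUnrˡ []       = refl
  split-strictToUnrˡ (unr s)  = cong (_ ∷_) (split-strictToUnrˡ s)
  split-strictToUnrˡ (irr s)  = cong (_ ∷_) (split-strictToUnrˡ s)
  split-strictToUnrˡ (strL s) = cong (_ ∷_) (split-strictToUnrˡ s)
  split-strictToUnrˡ (strR s) = cong (_ ∷_) (split-strictToUnrˡ s)

  split-strictToUnrʳ : ∀ {n} {Ψ Ψₘ Ψₙ : Ctx B n} → Split Ψ Ψₘ Ψₙ →
                       strictToUnr Ψₙ ≡ strictToUnr Ψ
  split-strictToUnrʳ = split-strictToUnrˡ ∘ split-swap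

  split-allUnrˡ : ∀ {n} {Ψ Ψₘ Ψₙ : Ctx B n} → Split Ψ Ψₘ Ψₙ → allUnr Ψₘ ≡ allUnr Ψ
  split-allUnrˡ []       = refl
  split-allUnrˡ (unr s)  = cong (_ ∷_) (split-allUnrˡ s)
  split-allUnrˡ (irr s)  = cong (_ ∷_) (split-allUnrˡ s)
  split-allUnrˡ (strL s) = cong (_ ∷_) (split-allUnrˡ s)
  split-allUnrˡ (strR s) = cong (_ ∷_) (split-allUnrˡ s)

  split-allUnrʳ : ∀ {n} {Ψ Ψₘ Ψₙ : Ctx B n} → Split Ψ Ψₘ Ψₙ → allUnr Ψₙ ≡ allUnr Ψ
  split-allUnrʳ = split-allUnrˡ ∘ split-swap

  split-NoStrictˡ : ∀ {n} {Ψ Ψₘ Ψₙ : Ctx B n} → Split Ψ Ψₘ Ψₙ → NoStrict Ψₘ → Ψₙ ≡ Ψ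
  split-NoStrictˡ []       ns = refl
  split-NoStrictˡ (unr s)  ns = cong (_ ∷_) (split-NoStrictˡ s (ns ∘ suc))
  split-NoStrictˡ (irr s)  ns = cong (_ ∷_) (split-NoStrictˡ s (ns ∘ suc))
  split-NoStrictˡ (strL s) ns = ⊥-elim (ns zero refl)
  split-NoStrictˡ (strR s) ns = cong (_ ∷_) (split-NoStrictˡ s (ns ∘ suc))

  split-∷ˡ : ∀ {n} k {A} {Ψ Ψₘ Ψₙ : Ctx B n} → Split Ψ Ψₘ Ψₙ →
             Split ((k , A) ∷ Ψ) ((k , A) ∷ Ψₘ) ((strictToUnrLabel k , A) ∷ Ψₙ)
  split-∷ˡ 𝟏 = strL
  split-∷ˡ 𝟎 = irr
  split-∷ˡ 𝐮 = unr

  split-∷ : ∀ {n x xₘ xₙ} {Ψ Ψₘ Ψₙ : Ctx B n} →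
            Split (x ∷ []) (xₘ ∷ []) (xₙ ∷ []) → Split Ψ Ψₘ Ψₙ →
            Split (x ∷ Ψ) (xₘ ∷ Ψₘ) (xₙ ∷ Ψₙ)
  split-∷ (unr [])  = unr
  split-∷ (irr [])  = irr
  split-∷ (strL []) = strL
  split-∷ (strR []) = strR

  split-≢𝟏 : ∀ {k} {A : Ty B} → k ≢ 𝟏 →
             Split ((k , A) ∷ []) ((k , A) ∷ []) ((k , A) ∷ [])
  split-≢𝟏 {𝟏} k≢𝟏 = ⊥-elim (k≢𝟏 refl)
  split-≢𝟏 {𝟎} k≢𝟏 = irr []
  split-≢𝟏 {𝐮} k≢𝟏 = unr []

  split-insertAt⁺ : ∀ {n} (p : Fin (suc n)) {x xₘ xₙ} {Ψ Ψₘ Ψₙ : Ctx B n} →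
                    Split (x ∷ []) (xₘ ∷ []) (xₙ ∷ []) → Split Ψ Ψₘ Ψₙ →
                    Split (insertAt Ψ p x) (insertAt Ψₘ p xₘ) (insertAt Ψₙ p xₙ)
  split-insertAt⁺ zero    d s        = split-∷ d s
  split-insertAt⁺ (suc p) d (unr s)  = unr (split-insertAt⁺ p d s)
  split-insertAt⁺ (suc p) d (irr s)  = irr (split-insertAt⁺ p d s)
  split-insertAt⁺ (suc p) d (strL s) = strL (split-insertAt⁺ p d s)
  split-insertAt⁺ (suc p) d (strR s) = strR (split-insertAt⁺ p d s)

  data SplitInsertAt {n} (p : Fin (suc n)) (x : Label × Ty B) (Ψ : Ctx B n) :
         Ctx B (suc n) → Ctx B (suc n) → Set where
    split-insertAt : ∀ {xₘ xₙ Ψₘ Ψₙ} →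
                     Split (x ∷ []) (xₘ ∷ []) (xₙ ∷ []) → Split Ψ Ψₘ Ψₙ →
                     SplitInsertAt p x Ψ (insertAt Ψₘ p xₘ) (insertAt Ψₙ p xₙ)

  split-insertAt⁻ : ∀ {n} (p : Fin (suc n)) {x} {Ψ : Ctx B n} {Φₘ Φₙ} →
                    Split (insertAt Ψ p x) Φₘ Φₙ → SplitInsertAt p x Ψ Φₘ Φₙ
  split-insertAt⁻ zero (unr s)  = split-insertAt (unr []) s
  split-insertAt⁻ zero (irr s)  = split-insertAt (irr []) s
  split-insertAt⁻ zero (strL s) = split-insertAt (strL []) s
  split-insertAt⁻ zero (strR s) = split-insertAt (strR []) s
  split-insertAt⁻ (suc p) {Ψ = _ ∷ _} (unr s) with split-insertAt⁻ p s
  ... | split-insertAt d s' = split-insertAt d (unr s')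
  split-insertAt⁻ (suc p) {Ψ = _ ∷ _} (irr s) with split-insertAt⁻ p s
  ... | split-insertAt d s' = split-insertAt d (irr s')
  split-insertAt⁻ (suc p) {Ψ = _ ∷ _} (strL s) with split-insertAt⁻ p s
  ... | split-insertAt d s' = split-insertAt d (strL s')
  split-insertAt⁻ (suc p) {Ψ = _ ∷ _} (strR s) with split-insertAt⁻ p s
  ... | split-insertAt d s' = split-insertAt d (strR s')

  ≼-≢𝟏 : ∀ {n} {Ψ Ψ' : Ctx B n} → Ψ ≼ Ψ' → ∀ j →
         proj₁ (lookup Ψ j) ≢ 𝟏 → proj₁ (lookup Ψ' j) ≢ 𝟏
  ≼-≢𝟏 (⊑-refl ∷ l) zero    k≢𝟏 = k≢𝟏
  ≼-≢𝟏 (𝟎⊑𝐮 ∷ l)    zero    _   = 𝐮≢𝟏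
  ≼-≢𝟏 (𝟏⊑𝐮 ∷ l)    zero    _   = 𝐮≢𝟏
  ≼-≢𝟏 (_ ∷ l)      (suc j) k≢𝟏 = ≼-≢𝟏 l j k≢𝟏

  ≼-lookup-𝐮 : ∀ {n} {Ψ Ψ' : Ctx B n} → Ψ ≼ Ψ' → ∀ i {A} →
               lookup Ψ i ≡ (𝐮 , A) → lookup Ψ' i ≡ (𝐮 , A)
  ≼-lookup-𝐮 (⊑-refl ∷ l) zero    e = e
  ≼-lookup-𝐮 (_ ∷ l)      (suc i) e = ≼-lookup-𝐮 l i e

  ≼-lookup-𝟏 : ∀ {n} {Ψ Ψ' : Ctx B n} → Ψ ≼ Ψ' → ∀ i {A} → lookup Ψ i ≡ (𝟏 , A) →
               lookup Ψ' i ≡ (𝟏 , A) ⊎ lookup Ψ' i ≡ (𝐮 , A)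
  ≼-lookup-𝟏 (⊑-refl ∷ l) zero    e    = inj₁ e
  ≼-lookup-𝟏 (𝟏⊑𝐮 ∷ l)    zero    refl = inj₂ refl
  ≼-lookup-𝟏 (_ ∷ l)      (suc i) e    = ≼-lookup-𝟏 l i e

  strictToUnr-mono-≼ : ∀ {n} {Ψ Ψ' : Ctx B n} → Ψ ≼ Ψ' → strictToUnr Ψ ≼ strictToUnr Ψ'
  strictToUnr-mono-≼ []                     = []
  strictToUnr-mono-≼ (_∷_ {k = 𝟏} ⊑-refl l) = ⊑-refl ∷ strictToUnr-mono-≼ l
  strictToUnr-mono-≼ (_∷_ {k = 𝟎} ⊑-refl l) = ⊑-refl ∷ strictToUnr-mono-≼ l
  strictToUnr-mono-≼ (_∷_ {k = 𝐮} ⊑-refl l) = ⊑-refl ∷ strictToUnr-mono-≼ l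
  strictToUnr-mono-≼ (𝟎⊑𝐮 ∷ l)            = 𝟎⊑𝐮 ∷ strictToUnr-mono-≼ l
  strictToUnr-mono-≼ (𝟏⊑𝐮 ∷ l)            = ⊑-refl ∷ strictToUnr-mono-≼ l

  allUnr-cong-≼ : ∀ {n} {Ψ Ψ' : Ctx B n} → Ψ ≼ Ψ' → allUnr Ψ ≡ allUnr Ψ'
  allUnr-cong-≼ []      = refl
  allUnr-cong-≼ (_ ∷ l) = cong (_ ∷_) (allUnr-cong-≼ l)

  ≼-split : ∀ {n} {Ψ Ψ' Ψₘ Ψₙ : Ctx B n} → Ψ ≼ Ψ' → Split Ψ Ψₘ Ψₙ →
            ∃[ Ψₘ' ] ∃[ Ψₙ' ] (Split Ψ' Ψₘ' Ψₙ' × Ψₘ ≼ Ψₘ' × Ψₙ ≼ Ψₙ')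
  ≼-split [] [] = _ , _ , [] , [] , []
  ≼-split (⊑-refl ∷ l) (unr s) with ≼-split l s
  ... | _ , _ , s' , lₘ , lₙ = _ , _ , unr s' , ⊑-refl ∷ lₘ , ⊑-refl ∷ lₙ
  ≼-split (⊑-refl ∷ l) (irr s) with ≼-split l s
  ... | _ , _ , s' , lₘ , lₙ = _ , _ , irr s' , ⊑-refl ∷ lₘ , ⊑-refl ∷ lₙ
  ≼-split (⊑-refl ∷ l) (strL s) with ≼-split l s
  ... | _ , _ , s' , lₘ , lₙ = _ , _ , strL s' , ⊑-refl ∷ lₘ , ⊑-refl ∷ lₙ
  ≼-split (⊑-refl ∷ l) (strR s) with ≼-split l s
  ... | _ , _ , s' , lₘ , lₙ = _ , _ , strR s' , ⊑-refl ∷ lₘ , ⊑-refl ∷ lₙ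
  ≼-split (𝟎⊑𝐮 ∷ l) (irr s) with ≼-split l s
  ... | _ , _ , s' , lₘ , lₙ = _ , _ , unr s' , 𝟎⊑𝐮 ∷ lₘ , 𝟎⊑𝐮 ∷ lₙ
  ≼-split (𝟏⊑𝐮 ∷ l) (strL s) with ≼-split l s
  ... | _ , _ , s' , lₘ , lₙ = _ , _ , unr s' , 𝟏⊑𝐮 ∷ lₘ , ⊑-refl ∷ lₙ
  ≼-split (𝟏⊑𝐮 ∷ l) (strR s) with ≼-split l s
  ... | _ , _ , s' , lₘ , lₙ = _ , _ , unr s' , ⊑-refl ∷ lₘ , 𝟏⊑𝐮 ∷ lₙ

  Ψ≼strictToUnrΨ : ∀ {n} (Ψ : Ctx B n) → Ψ ≼ strictToUnr Ψ
  Ψ≼strictToUnrΨ []            = []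
  Ψ≼strictToUnrΨ ((𝟏 , A) ∷ Ψ) = 𝟏⊑𝐮 ∷ Ψ≼strictToUnrΨ Ψ
  Ψ≼strictToUnrΨ ((𝟎 , A) ∷ Ψ) = ⊑-refl ∷ Ψ≼strictToUnrΨ Ψ
  Ψ≼strictToUnrΨ ((𝐮 , A) ∷ Ψ) = ⊑-refl ∷ Ψ≼strictToUnrΨ Ψ

  Ψ≼allUnrΨ : ∀ {n} (Ψ : Ctx B n) → Ψ ≼ allUnr Ψ
  Ψ≼allUnrΨ []            = []
  Ψ≼allUnrΨ ((𝟏 , A) ∷ Ψ) = 𝟏⊑𝐮 ∷ Ψ≼allUnrΨ Ψ
  Ψ≼allUnrΨ ((𝟎 , A) ∷ Ψ) = 𝟎⊑𝐮 ∷ Ψ≼allUnrΨ Ψ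
  Ψ≼allUnrΨ ((𝐮 , A) ∷ Ψ) = ⊑-refl ∷ Ψ≼allUnrΨ Ψ

ext-punchIn : ∀ {n} {p : Fin (suc n)} {ρ : Fin n → Fin (suc n)} →
              ρ ≗ punchIn p → ext ρ ≗ punchIn (suc p)
ext-punchIn ρ≗ zero    = refl
ext-punchIn ρ≗ (suc j) = cong suc (ρ≗ j)

module _ {B K : Set} where

  -- exts (sub0 N) agrees with the substitution at position 1 only pointwise, so
  -- substitutions are characterised by their values rather than defined.
  record IsSingleSubst {n} (p : Fin (suc n)) (N : Tm B K n)
                       (σ : Fin (suc n) → Tm B K n) : Set where
    field
      hit  : σ p ≡ N
      miss : ∀ j → σ (punchIn p j) ≡ var j

  open IsSingleSubst public

  IsSingleSubst-exts : ∀ {n} {p : Fin (suc n)} {N σ} →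
                       IsSingleSubst p N σ → IsSingleSubst (suc p) (rename suc N) (exts σ)
  hit  (IsSingleSubst-exts sσ)         = cong (rename suc) (hit sσ)
  miss (IsSingleSubst-exts sσ) zero    = refl
  miss (IsSingleSubst-exts sσ) (suc j) = cong (rename suc) (miss sσ j)

  sub0-IsSingleSubst : ∀ {n} (N : Tm B K n) → IsSingleSubst zero N (sub0 N)
  sub0-IsSingleSubst N = record { hit = refl ; miss = λ _ → refl }

module _ {B K : Set} (Σ : K → Ty B) where

  ⊢-cast : ∀ {n} {Ψ Ψ' : Ctx B n} {M C} → Ψ ≡ Ψ' → Σ ∣ Ψ ⊢ M ⦂ C → Σ ∣ Ψ' ⊢ M ⦂ C
  ⊢-cast refl h = h

  promote : ∀ {n} {Ψ Ψ' : Ctx B n} {M C} → Ψ ≼ Ψ' → Σ ∣ Ψ ⊢ M ⦂ C → Σ ∣ Ψ' ⊢ M ⦂ C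
  promote l (t-con ns)            = t-con (λ j → ≼-≢𝟏 l j (ns j))
  promote l (t-varU {i = i} e ns)  = t-varU (≼-lookup-𝐮 l i e) (λ j → ≼-≢𝟏 l j (ns j))
  promote {Ψ' = Ψ'} l (t-var1 {i = i} e os) with ≼-lookup-𝟏 l i e
  ... | inj₁ e' = t-var1 e' (λ j j≢i → ≼-≢𝟏 l j (os j j≢i))
  ... | inj₂ e' = t-varU e' noStrict
    where
    noStrict : NoStrict Ψ'
    noStrict j with j ≟ i
    ... | yes refl = λ k≡𝟏 → 𝐮≢𝟏 (trans (sym (cong proj₁ e')) k≡𝟏)
    ... | no j≢i   = ≼-≢𝟏 l j (os j j≢i)
  promote l (t-lam h)        = t-lam (promote (⊑-refl ∷ l) h)
  promote l (t-appU hm hn)   = t-appU (promote l hm) (promote (strictToUnr-mono-≼ l) hn)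
  promote l (t-app0 hm hn)   = t-app0 (promote l hm) (⊢-cast (allUnr-cong-≼ l) hn)
  promote l (t-app1 s hm hn) with ≼-split l s
  ... | _ , _ , s' , lₘ , lₙ = t-app1 s' (promote lₘ hm) (promote lₙ hn)

  ⊢-strictToUnr : ∀ {n} {Ψ : Ctx B n} {M C} → Σ ∣ Ψ ⊢ M ⦂ C → Σ ∣ strictToUnr Ψ ⊢ M ⦂ C
  ⊢-strictToUnr = promote (Ψ≼strictToUnrΨ _)

  ⊢-allUnr : ∀ {n} {Ψ : Ctx B n} {M C} → Σ ∣ Ψ ⊢ M ⦂ C → Σ ∣ allUnr Ψ ⊢ M ⦂ C
  ⊢-allUnr = promote (Ψ≼allUnrΨ _)

  ⊢-strictToUnr-splitʳ : ∀ {n} {Ψ Ψₘ Ψₙ : Ctx B n} {N A} → Split Ψ Ψₘ Ψₙ →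
                         Σ ∣ Ψₙ ⊢ N ⦂ A → Σ ∣ strictToUnr Ψₘ ⊢ N ⦂ A
  ⊢-strictToUnr-splitʳ s h =
    ⊢-cast (trans (split-strictToUnrʳ s) (sym (split-strictToUnrˡ s))) (⊢-strictToUnr h)

  ⊢-allUnr-splitʳ : ∀ {n} {Ψ Ψₘ Ψₙ : Ctx B n} {N A} → Split Ψ Ψₘ Ψₙ →
                    Σ ∣ Ψₙ ⊢ N ⦂ A → Σ ∣ allUnr Ψₘ ⊢ N ⦂ A
  ⊢-allUnr-splitʳ s h =
    ⊢-cast (trans (split-allUnrʳ s) (sym (split-allUnrˡ s))) (⊢-allUnr h)

  weaken : ∀ {n} {p : Fin (suc n)} {ρ} {k A} {Ψ : Ctx B n} {M C} →
           ρ ≗ punchIn p → k ≢ 𝟏 →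
           Σ ∣ Ψ ⊢ M ⦂ C → Σ ∣ insertAt Ψ p (k , A) ⊢ rename ρ M ⦂ C
  weaken {p = p} {Ψ = Ψ} ρ≗ k≢𝟏 (t-con ns) = t-con (NoStrict-insertAt⁺ Ψ p k≢𝟏 ns)
  weaken {p = p} {Ψ = Ψ} ρ≗ k≢𝟏 (t-varU {i = i} e ns) rewrite ρ≗ i =
    t-varU (trans (insertAt-punchIn Ψ p _ i) e) (NoStrict-insertAt⁺ Ψ p k≢𝟏 ns)
  weaken {p = p} {Ψ = Ψ} ρ≗ k≢𝟏 (t-var1 {i = i} e os) rewrite ρ≗ i =
    t-var1 (trans (insertAt-punchIn Ψ p _ i) e) (OnlyStrict-insertAt⁺ Ψ p k≢𝟏 os)
  weaken ρ≗ k≢𝟏 (t-lam h) = t-lam (weaken (ext-punchIn ρ≗) k≢𝟏 h)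
  weaken {p = p} {k = k} {Ψ = Ψ} ρ≗ k≢𝟏 (t-appU hm hn) =
    t-appU (weaken ρ≗ k≢𝟏 hm)
           (⊢-cast (sym (strictToUnr-insertAt Ψ p k)) (weaken ρ≗ (strictToUnrLabel≢𝟏 k) hn))
  weaken {p = p} {Ψ = Ψ} ρ≗ k≢𝟏 (t-app0 hm hn) =
    t-app0 (weaken ρ≗ k≢𝟏 hm) (⊢-cast (sym (allUnr-insertAt Ψ p)) (weaken ρ≗ 𝐮≢𝟏 hn))
  weaken {p = p} ρ≗ k≢𝟏 (t-app1 s hm hn) =
    t-app1 (split-insertAt⁺ p (split-≢𝟏 k≢𝟏) s) (weaken ρ≗ k≢𝟏 hm) (weaken ρ≗ k≢𝟏 hn)

  weaken-∷ : ∀ {n} {k A'} {Ψ : Ctx B n} {N A} → k ≢ 𝟏 →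
             Σ ∣ Ψ ⊢ N ⦂ A → Σ ∣ (k , A') ∷ Ψ ⊢ rename suc N ⦂ A
  weaken-∷ = weaken {p = zero} (λ _ → refl)

  ⊢-miss : ∀ {n} {p : Fin (suc n)} {N σ} {Ψ : Ctx B n} {j C} → IsSingleSubst p N σ →
           Σ ∣ Ψ ⊢ var j ⦂ C → Σ ∣ Ψ ⊢ σ (punchIn p j) ⦂ C
  ⊢-miss {j = j} sσ h rewrite miss sσ j = h

  subst-𝐮 : ∀ {n} {p : Fin (suc n)} {N σ} {Ψ : Ctx B n} {A M C} → IsSingleSubst p N σ →
            Σ ∣ insertAt Ψ p (𝐮 , A) ⊢ M ⦂ C → Σ ∣ strictToUnr Ψ ⊢ N ⦂ A →
            Σ ∣ Ψ ⊢ subst σ M ⦂ C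
  subst-𝐮 {p = p} {Ψ = Ψ} sσ (t-con ns) hN = t-con (proj₂ (NoStrict-insertAt⁻ Ψ p ns))
  subst-𝐮 {p = p} {Ψ = Ψ} sσ (t-varU {i = i} e ns) hN with lookupInsertAt Ψ p i e
  ... | here refl rewrite hit sσ =
    ⊢-cast (NoStrict⇒strictToUnr≡id Ψ (proj₂ (NoStrict-insertAt⁻ Ψ p ns))) hN
  ... | there j e' = ⊢-miss sσ (t-varU e' (proj₂ (NoStrict-insertAt⁻ Ψ p ns)))
  subst-𝐮 {p = p} {Ψ = Ψ} sσ (t-var1 {i = i} e os) hN with lookupInsertAt Ψ p i e
  ... | there j e' = ⊢-miss sσ (t-var1 e' (proj₂ (OnlyStrict-insertAt⁻ Ψ p os)))
  subst-𝐮 {Ψ = Ψ} sσ (t-lam {k = k} h) hN =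
    t-lam (subst-𝐮 (IsSingleSubst-exts sσ) h
                   (⊢-cast (sym (strictToUnr-insertAt Ψ zero k))
                           (weaken-∷ (strictToUnrLabel≢𝟏 k) hN)))
  subst-𝐮 {p = p} {Ψ = Ψ} sσ (t-appU hm hn) hN =
    t-appU (subst-𝐮 sσ hm hN)
           (subst-𝐮 sσ (⊢-cast (strictToUnr-insertAt Ψ p 𝐮) hn)
                       (⊢-cast (sym (strictToUnr-idem Ψ)) hN))
  subst-𝐮 {p = p} {Ψ = Ψ} sσ (t-app0 hm hn) hN =
    t-app0 (subst-𝐮 sσ hm hN)
           (subst-𝐮 sσ (⊢-cast (allUnr-insertAt Ψ p) hn)
                       (⊢-cast (trans (allUnr-strictToUnr Ψ) (sym (strictToUnr-allUnr Ψ)))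
                               (⊢-allUnr hN)))
  subst-𝐮 {p = p} sσ (t-app1 s hm hn) hN with split-insertAt⁻ p s
  ... | split-insertAt (unr []) s' =
    t-app1 s' (subst-𝐮 sσ hm (⊢-cast (sym (split-strictToUnrˡ s')) hN))
              (subst-𝐮 sσ hn (⊢-cast (sym (split-strictToUnrʳ s')) hN))

  subst-𝟎 : ∀ {n} {p : Fin (suc n)} {N σ} {Ψ : Ctx B n} {A M C} → IsSingleSubst p N σ →
            Σ ∣ insertAt Ψ p (𝟎 , A) ⊢ M ⦂ C → Σ ∣ allUnr Ψ ⊢ N ⦂ A →
            Σ ∣ Ψ ⊢ subst σ M ⦂ C
  subst-𝟎 {p = p} {Ψ = Ψ} sσ (t-con ns) hN = t-con (proj₂ (NoStrict-insertAt⁻ Ψ p ns))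
  subst-𝟎 {p = p} {Ψ = Ψ} sσ (t-varU {i = i} e ns) hN with lookupInsertAt Ψ p i e
  ... | there j e' = ⊢-miss sσ (t-varU e' (proj₂ (NoStrict-insertAt⁻ Ψ p ns)))
  subst-𝟎 {p = p} {Ψ = Ψ} sσ (t-var1 {i = i} e os) hN with lookupInsertAt Ψ p i e
  ... | there j e' = ⊢-miss sσ (t-var1 e' (proj₂ (OnlyStrict-insertAt⁻ Ψ p os)))
  subst-𝟎 sσ (t-lam h) hN = t-lam (subst-𝟎 (IsSingleSubst-exts sσ) h (weaken-∷ 𝐮≢𝟏 hN))
  subst-𝟎 {p = p} {Ψ = Ψ} sσ (t-appU hm hn) hN =
    t-appU (subst-𝟎 sσ hm hN)
           (subst-𝟎 sσ (⊢-cast (strictToUnr-insertAt Ψ p 𝟎) hn)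
                       (⊢-cast (sym (allUnr-strictToUnr Ψ)) hN))
  subst-𝟎 {p = p} {Ψ = Ψ} sσ (t-app0 hm hn) hN =
    t-app0 (subst-𝟎 sσ hm hN)
           (subst-𝐮 sσ (⊢-cast (allUnr-insertAt Ψ p) hn)
                       (⊢-cast (sym (strictToUnr-allUnr Ψ)) hN))
  subst-𝟎 {p = p} sσ (t-app1 s hm hn) hN with split-insertAt⁻ p s
  ... | split-insertAt (irr []) s' =
    t-app1 s' (subst-𝟎 sσ hm (⊢-cast (sym (split-allUnrˡ s')) hN))
              (subst-𝟎 sσ hn (⊢-cast (sym (split-allUnrʳ s')) hN))

  subst-𝟏 : ∀ {n} {p : Fin (suc n)} {N σ} {Ψ Ψₘ Ψₙ : Ctx B n} {A M C} →
            IsSingleSubst p N σ → Split Ψ Ψₘ Ψₙ →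
            Σ ∣ insertAt Ψₘ p (𝟏 , A) ⊢ M ⦂ C → Σ ∣ Ψₙ ⊢ N ⦂ A →
            Σ ∣ Ψ ⊢ subst σ M ⦂ C
  subst-𝟏 {p = p} {Ψₘ = Ψₘ} sσ s (t-con ns) hN =
    ⊥-elim (proj₁ (NoStrict-insertAt⁻ Ψₘ p ns) refl)
  subst-𝟏 {p = p} {Ψₘ = Ψₘ} sσ s (t-varU e ns) hN =
    ⊥-elim (proj₁ (NoStrict-insertAt⁻ Ψₘ p ns) refl)
  subst-𝟏 {p = p} {Ψₘ = Ψₘ} sσ s (t-var1 {i = i} e os) hN with lookupInsertAt Ψₘ p i e
  ... | here refl rewrite hit sσ =
    ⊢-cast (split-NoStrictˡ s (OnlyStrict-insertAt-here Ψₘ p os)) hN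
  ... | there j e' = ⊥-elim (proj₁ (OnlyStrict-insertAt⁻ Ψₘ p os) refl)
  subst-𝟏 sσ s (t-lam {k = k} h) hN =
    t-lam (subst-𝟏 (IsSingleSubst-exts sσ) (split-∷ˡ k s) h
                   (weaken-∷ (strictToUnrLabel≢𝟏 k) hN))
  subst-𝟏 {p = p} {Ψₘ = Ψₘ} sσ s (t-appU hm hn) hN =
    t-appU (subst-𝟏 sσ s hm hN)
           (⊢-cast (split-strictToUnrˡ s)
             (subst-𝐮 sσ (⊢-cast (strictToUnr-insertAt Ψₘ p 𝟏) hn)
                         (⊢-cast (sym (strictToUnr-idem Ψₘ)) (⊢-strictToUnr-splitʳ s hN))))
  subst-𝟏 {p = p} {Ψₘ = Ψₘ} sσ s (t-app0 hm hn) hN =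
    t-app0 (subst-𝟏 sσ s hm hN)
           (⊢-cast (split-allUnrˡ s)
             (subst-𝐮 sσ (⊢-cast (allUnr-insertAt Ψₘ p) hn)
                         (⊢-cast (sym (strictToUnr-allUnr Ψₘ)) (⊢-allUnr-splitʳ s hN))))
  subst-𝟏 {p = p} sσ s (t-app1 s₁₂ hm hn) hN with split-insertAt⁻ p s₁₂
  ... | split-insertAt (strL []) s' with split-assoc s (split-swap s')
  ...   | _ , a , b =
    t-app1 (split-swap a) (subst-𝟏 sσ b hm hN)
           (subst-𝐮 sσ hn (⊢-cast (sym (split-strictToUnrʳ s'))
                                  (⊢-strictToUnr-splitʳ s hN)))
  subst-𝟏 {p = p} sσ s (t-app1 s₁₂ hm hn) hN | split-insertAt (strR []) s' with split-assoc s s'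
  ...   | _ , a , b =
    t-app1 a (subst-𝐮 sσ hm (⊢-cast (sym (split-strictToUnrˡ s'))
                                    (⊢-strictToUnr-splitʳ s hN)))
             (subst-𝟏 sσ b hn hN)

lemma3p4 : ∀ {B K : Set} (Σ : K → Ty B) {n : ℕ} →
    -- (1) unrestricted x
    (∀ {Ψ : Ctx B n} {A C : Ty B} {M N} →
       Σ ∣ (𝐮 , A) ∷ Ψ ⊢ M ⦂ C → Σ ∣ strictToUnr Ψ ⊢ N ⦂ A →
       Σ ∣ Ψ ⊢ M [ N ] ⦂ C)
    -- (2) irrelevant x
    × (∀ {Ψ : Ctx B n} {A C : Ty B} {M N} →
       Σ ∣ (𝟎 , A) ∷ Ψ ⊢ M ⦂ C → Σ ∣ allUnr Ψ ⊢ N ⦂ A →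
       Σ ∣ Ψ ⊢ M [ N ] ⦂ C)
    -- (3) strict x
    × (∀ {Ψ Ψₘ Ψₙ : Ctx B n} {A C : Ty B} {M N} → Split Ψ Ψₘ Ψₙ →
       Σ ∣ (𝟏 , A) ∷ Ψₘ ⊢ M ⦂ C → Σ ∣ Ψₙ ⊢ N ⦂ A →
       Σ ∣ Ψ ⊢ M [ N ] ⦂ C)
lemma3p4 Σ =
    (λ {N = N} h hN → subst-𝐮 Σ (sub0-IsSingleSubst N) h hN)
  , (λ {N = N} h hN → subst-𝟎 Σ (sub0-IsSingleSubst N) h hN)
  , (λ {N = N} s h hN → subst-𝟏 Σ (sub0-IsSingleSubst N) s h hN)
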